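{- Let $\underline{S_2}=\lambda n\lambda f\lambda x ((n)f)(f)x$. There is an $\underline{S_2}$-storage operator which is not a storage operator.
   Context: Notation: $(t)u$ denotes application of $t$ to $u$, and $(t)u_1\dots u_n$ stands for $(\dots((t)u_1)\dots)u_n$; $\overline{c}$ denotes a finite sequence of terms. $u \succ v$ means $v$ is obtained from $u$ by finitely many head-reduction steps. $(u)^0v=v$, $(u)^{n+1}v=(u)(u)^nv$. Church integers: $\underline{n}=\lambda f\lambda x (f)^n x$. A closed $\lambda$-term $\underline{S}$ is a successor iff $(\underline{S})\underline{k}\simeq_\beta \underline{k+1}$ for every $k\ge 0$ ($\underline{S_2}$ is a successor). A closed $\lambda$-term $T$ is a storage operator iff for every $n\ge 0$ there is a closed $\lambda$-term $\tau_n\simeq_\beta \underline{n}$ such that for every $\theta_n\simeq_\beta\underline{n}$, $(T)\theta_n f \succ (f)\tau_n$ (where $f$ is a fresh variable). $\lambda X$-terms: terms built from variables and constants $X_i$ ($i\ge 0$) by abstraction and application, together with constants $X_{n,a,b,\overline{c}}$ for every $n\in\mathbb N$ and $\lambda X$-terms $a,b,\overline{c}$ ($X_{n,a,b,\overline{c}}$ is regarded as a constant not occurring in $a,b,\overline{c}$). Given a successor $\underline{S}$, a closed $\lambda$-term $T$ is an $\underline{S}$-storage operator iff for every $n\ge 0$ there is a finite sequence of head reductions $U_i\succ V_i$ ($1\le i\le r$) such that: (1) all $U_i,V_i$ are $\lambda X$-terms; (2) $U_1=(T)X_n f$ and $V_r=(f)\tau_n$ with $\tau_n$ a closed $\lambda$-term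 $\beta$-equivalent to $\underline{n}$; (3) for $i<r$, $V_i=(X_n)ab\overline{c}$ or $V_i=(X_{l,a,b,\overline{c}})uv\overline{w}$ with $0\le l\le n-1$; (4) if $V_i=(X_n)ab\overline{c}$ then $U_{i+1}=(\underline{0})ab\overline{c}$ if $n=0$ and $U_{i+1}=((\underline{S})X_{n-1,a,b,\overline{c}})ab\overline{c}$ if $n\ne 0$; (5) if $V_i=(X_{l,a,b,\overline{c}})uv\overline{w}$ then $U_{i+1}=(\underline{0})uv\overline{w}$ if $l=0$ and $U_{i+1}=((\underline{S})X_{l-1,u,v,\overline{w}})uv\overline{w}$ if $l\ne 0$. -}

module Defs where

open import Data.Nat using (ℕ; zero; suc; _<_; _∸_)
open import Data.List using (List; []; _∷_)
open import Data.Product using (Σ; _×_; _,_)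
open import Relation.Nullary using (¬_)
open import Relation.Binary.Construct.Closure.ReflexiveTransitive using (Star)
open import Relation.Binary.Construct.Closure.Equivalence using (EqClosure)

-- The constants X_i and X_{n,a,b,c̄} are atomic: substitution
-- and shifting do not enter the terms a, b, c̄ that index a constant.

data Tm : Set where
  var : ℕ → Tm
  lam : Tm → Tm
  app : Tm → Tm → Tm
  X   : ℕ → Tm
  Xc  : ℕ → Tm → Tm → List Tm → Tm

apps : Tm → List Tm → Tm
apps t []       = t
apps t (u ∷ us) = apps (app t u) us

shiftIdx : ℕ → ℕ → ℕ
shiftIdx zero    x       = suc x
shiftIdx (suc c) zero    = zero
shiftIdx (suc c) (suc x) = suc (shiftIdx c x)

shift : ℕ → Tm → Tm
shift c (var x)        = var (shiftIdx c x)
shift c (lam t)        = lam (shift (suc c) t)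
shift c (app t u)      = app (shift c t) (shift c u)
shift c (X i)          = X i
shift c (Xc n a b cs)  = Xc n a b cs

subVar : ℕ → ℕ → Tm → Tm
subVar zero    zero    u = u
subVar zero    (suc x) u = var x
subVar (suc k) zero    u = var zero
subVar (suc k) (suc x) u = shift 0 (subVar k x u)

sub : ℕ → Tm → Tm → Tm
sub k u (var x)       = subVar k x u
sub k u (lam t)       = lam (sub (suc k) u t)
sub k u (app t v)     = app (sub k u t) (sub k u v)
sub k u (X i)         = X i
sub k u (Xc n a b cs) = Xc n a b cs

_[_] : Tm → Tm → Tm
t [ u ] = sub 0 u t

data _⟶w_ : Tm → Tm → Set where
  wβ   : ∀ {t u} → app (lam t) u ⟶w (t [ u ])
  wapp : ∀ {t t' u} → t ⟶w t' → app t u ⟶w app t' u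

data _⟶h_ : Tm → Tm → Set where
  hw   : ∀ {t t'} → t ⟶w t' → t ⟶h t'
  hlam : ∀ {t t'} → t ⟶h t' → lam t ⟶h lam t'

_≻_ : Tm → Tm → Set
_≻_ = Star _⟶h_

data _⟶β_ : Tm → Tm → Set where
  β    : ∀ {t u} → app (lam t) u ⟶β (t [ u ])
  ξlam : ∀ {t t'} → t ⟶β t' → lam t ⟶β lam t'
  ξl   : ∀ {t t' u} → t ⟶β t' → app t u ⟶β app t' u
  ξr   : ∀ {t u u'} → u ⟶β u' → app t u ⟶β app t u'

_≃β_ : Tm → Tm → Set
_≃β_ = EqClosure _⟶β_

data PureScope : ℕ → Tm → Set where
  pvar : ∀ {k x} → x < k → PureScope k (var x)
  plam : ∀ {k t} → PureScope (suc k) t → PureScope k (lam t)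
  papp : ∀ {k t u} → PureScope k t → PureScope k u → PureScope k (app t u)

ClosedλTerm : Tm → Set
ClosedλTerm = PureScope 0

iterApp : ℕ → Tm → Tm → Tm
iterApp zero    u v = v
iterApp (suc n) u v = app u (iterApp n u v)

church : ℕ → Tm
church n = lam (lam (iterApp n (var 1) (var 0)))

S₂ : Tm
S₂ = lam (lam (lam (app (app (var 2) (var 1)) (app (var 1) (var 0)))))

-- the fresh variable f (T, θ, τ are closed, so index 0 is free and fresh)
f : Tm
f = var 0

StorageOperator : Tm → Set
StorageOperator T =
  ClosedλTerm T ×
  ((n : ℕ) → Σ Tm λ τ → ClosedλTerm τ × (τ ≃β church n) ×
     ((θ : Tm) → ClosedλTerm θ → θ ≃β church n → app (app T θ) f ≻ app f τ))

-- the term U_{i+1} determined by conditions (4)/(5):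
-- (0̲) a b c̄  if the index is 0,  ((S̲) X_{m,a,b,c̄}) a b c̄ if the index is m+1
next : Tm → ℕ → Tm → Tm → List Tm → Tm
next S zero    a b cs = apps (church 0) (a ∷ b ∷ cs)
next S (suc m) a b cs = apps (app S (Xc m a b cs)) (a ∷ b ∷ cs)

-- Chain S n τ U : there is a finite sequence U = U₁ ≻ V₁, …, U_r ≻ V_r
-- satisfying conditions (2)–(5) (except U₁ = (T)X_n f), with V_r = (f)τ.
data Chain (S : Tm) (n : ℕ) (τ : Tm) : Tm → Set where
  done   : ∀ {U} → U ≻ app f τ → Chain S n τ U
  stepX  : ∀ {U a b cs} → U ≻ apps (X n) (a ∷ b ∷ cs) →
           Chain S n τ (next S n a b cs) → Chain S n τ U
  stepXc : ∀ {U l a b cs u v ws} → l < n →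
           U ≻ apps (Xc l a b cs) (u ∷ v ∷ ws) →
           Chain S n τ (next S l u v ws) → Chain S n τ U

S-StorageOperator : Tm → Tm → Set
S-StorageOperator S T =
  ClosedλTerm T ×
  ((n : ℕ) → Σ Tm λ τ → ClosedλTerm τ × (τ ≃β church n) ×
     Chain S n τ (app (app T (X n)) f))

-- The operator is T = λν λf (ν) A B f with A = λx λy (y)(x)S₂ and B = λy (y)0̲, so
-- (T)θ f replays the head reduction of (θ) A B f.  On the constant Xₙ the
-- S₂-unfolding turns B into (A)ⁿB, which reduces with f to (f)τₙ where
-- τ₀ = 0̲ and τₘ₊₁ = ((A)ᵐB)S₂ ≃β (S₂)τₘ, a Church numeral.  But τ records the
-- syntax of θ: for 1̲ and the β-equal λfλx (f)((λy y)x) the head normal forms of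
-- (T)θ f are (f)((B)S₂) and (f)(((λy y)B)S₂), and head reduction is deterministic.
module Submission where

open import Defs
open import Data.Product using (Σ; _×_; _,_)
open import Relation.Nullary using (¬_)
open import Data.Empty using (⊥-elim)
open import Data.Nat using (ℕ; zero; suc; _+_; _≤_; z≤n; s≤s; z<s; s<s)
open import Data.Nat.Properties using (+-suc; +-identityʳ; ≤-trans; m≤m+n)
open import Data.List using ([]; _∷_)
open import Function using (_∘_)
open import Relation.Binary.PropositionalEquality
  using (_≡_; refl; trans; cong; cong₂; subst)
open import Relation.Binary.Construct.Closure.ReflexiveTransitive
  using (ε; _◅_; _◅◅_)
import Relation.Binary.Construct.Closure.ReflexiveTransitive as Star
open import Relation.Binary.Construct.Closure.Symmetric using (fwd)
import Relation.Binary.Construct.Closure.Equivalence as EqClosure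
import Relation.Binary.Reasoning.Setoid as SetoidReasoning

sub-shift : ∀ k u t → sub k u (shift k t) ≡ t
sub-shift k u (var x)       = subVar-shiftIdx k x
  where
  subVar-shiftIdx : ∀ k x → subVar k (shiftIdx k x) u ≡ var x
  subVar-shiftIdx zero    x       = refl
  subVar-shiftIdx (suc k) zero    = refl
  subVar-shiftIdx (suc k) (suc x) = cong (shift 0) (subVar-shiftIdx k x)
sub-shift k u (lam t)       = cong lam (sub-shift (suc k) u t)
sub-shift k u (app t v)     = cong₂ app (sub-shift k u t) (sub-shift k u v)
sub-shift k u (X i)         = refl
sub-shift k u (Xc n a b cs) = refl

iterApp-shift : ∀ c n a b → shift c (iterApp n a b) ≡ iterApp n (shift c a) (shift c b)
iterApp-shift c zero    a b = refl
iterApp-shift c (suc n) a b = cong (app (shift c a)) (iterApp-shift c n a b)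

iterApp-sub : ∀ k u n a b → sub k u (iterApp n a b) ≡ iterApp n (sub k u a) (sub k u b)
iterApp-sub k u zero    a b = refl
iterApp-sub k u (suc n) a b = cong (app (sub k u a)) (iterApp-sub k u n a b)

iterApp-suc : ∀ n a b → iterApp n a (app a b) ≡ iterApp (suc n) a b
iterApp-suc zero    a b = refl
iterApp-suc (suc n) a b = cong (app a) (iterApp-suc n a b)

church-shift : ∀ c n → shift c (church n) ≡ church n
church-shift c n = cong (lam ∘ lam) (iterApp-shift (suc (suc c)) n (var 1) (var 0))

PureScope-weaken : ∀ {j k t} → j ≤ k → PureScope j t → PureScope k t
PureScope-weaken j≤k (pvar x<j) = pvar (≤-trans x<j j≤k)
PureScope-weaken j≤k (plam t)   = plam (PureScope-weaken (s≤s j≤k) t)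
PureScope-weaken j≤k (papp t u) = papp (PureScope-weaken j≤k t) (PureScope-weaken j≤k u)

closed-weaken : ∀ {k t} → ClosedλTerm t → PureScope k t
closed-weaken = PureScope-weaken z≤n

church-closed : ∀ n → ClosedλTerm (church n)
church-closed n = plam (plam (body n))
  where
  body : ∀ n → PureScope 2 (iterApp n (var 1) (var 0))
  body zero    = pvar z<s
  body (suc n) = papp (pvar (s<s z<s)) (body n)

S₂-closed : ClosedλTerm S₂
S₂-closed = plam (plam (plam
  (papp (papp (pvar (s<s (s<s z<s))) (pvar (s<s z<s))) (papp (pvar (s<s z<s)) (pvar z<s)))))

⟶w⇒⟶β : ∀ {t u} → t ⟶w u → t ⟶β u
⟶w⇒⟶β wβ       = β
⟶w⇒⟶β (wapp s) = ξl (⟶w⇒⟶β s)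

⟶h⇒⟶β : ∀ {t u} → t ⟶h u → t ⟶β u
⟶h⇒⟶β (hw s)   = ⟶w⇒⟶β s
⟶h⇒⟶β (hlam s) = ξlam (⟶h⇒⟶β s)

≻⇒≃β : ∀ {t u} → t ≻ u → t ≃β u
≻⇒≃β = Star.map (fwd ∘ ⟶h⇒⟶β)

≻-step : ∀ {t u} → t ⟶w u → t ≻ u
≻-step = Star.return ∘ hw

β-step : ∀ {t u} → t ⟶β u → t ≃β u
β-step = EqClosure.return

app-congʳ : ∀ {t u u'} → u ≃β u' → app t u ≃β app t u'
app-congʳ {t} = EqClosure.gmap (app t) ξr

S₂-church : ∀ n → app S₂ (church n) ≃β church (suc n)
S₂-church n = begin
  app S₂ (church n)
    ≈⟨ β-step β ⟩
  lam (lam (app (app (shift 0 (shift 0 (church n))) (var 1)) (app (var 1) (var 0))))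
    ≡⟨ cong (λ ν → lam (lam (app (app ν (var 1)) (app (var 1) (var 0)))))
            (trans (cong (shift 0) (church-shift 0 n)) (church-shift 0 n)) ⟩
  lam (lam (app (app (church n) (var 1)) (app (var 1) (var 0))))
    ≈⟨ β-step (ξlam (ξlam (ξl β))) ⟩
  lam (lam (app (lam (sub 1 (var 1) (iterApp n (var 1) (var 0)))) (app (var 1) (var 0))))
    ≡⟨ cong (λ t → lam (lam (app (lam t) (app (var 1) (var 0)))))
            (iterApp-sub 1 (var 1) n (var 1) (var 0)) ⟩
  lam (lam (app (lam (iterApp n (var 2) (var 0))) (app (var 1) (var 0))))
    ≈⟨ β-step (ξlam (ξlam β)) ⟩
  lam (lam (sub 0 (app (var 1) (var 0)) (iterApp n (var 2) (var 0))))
    ≡⟨ cong (lam ∘ lam) (trans (iterApp-sub 0 (app (var 1) (var 0)) n (var 2) (var 0))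
                               (iterApp-suc n (var 1) (var 0))) ⟩
  church (suc n) ∎
  where open SetoidReasoning (EqClosure.setoid _⟶β_)

⟶w-deterministic : ∀ {t u v} → t ⟶w u → t ⟶w v → u ≡ v
⟶w-deterministic wβ       wβ        = refl
⟶w-deterministic (wapp s) (wapp s') = cong (λ t → app t _) (⟶w-deterministic s s')

⟶h-deterministic : ∀ {t u v} → t ⟶h u → t ⟶h v → u ≡ v
⟶h-deterministic (hw s)   (hw s')   = ⟶w-deterministic s s'
⟶h-deterministic (hlam s) (hlam s') = cong lam (⟶h-deterministic s s')

HeadNormal : Tm → Set
HeadNormal t = ∀ {u} → ¬ (t ⟶h u)

app-var-headNormal : ∀ {x t} → HeadNormal (app (var x) t)
app-var-headNormal (hw (wapp ()))

≻-headNormal-unique : ∀ {t u v} → HeadNormal u → HeadNormal v → t ≻ u → t ≻ v → u ≡ v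
≻-headNormal-unique nu nv ε       ε         = refl
≻-headNormal-unique nu nv ε       (s ◅ _)   = ⊥-elim (nu s)
≻-headNormal-unique nu nv (s ◅ _) ε         = ⊥-elim (nv s)
≻-headNormal-unique nu nv (s ◅ r) (s' ◅ r')
  rewrite ⟶h-deterministic s s' = ≻-headNormal-unique nu nv r r'

≻-app-var-functional : ∀ {t x u v} → t ≻ app (var x) u → t ≻ app (var x) v → u ≡ v
≻-app-var-functional r r'
  with refl ← ≻-headNormal-unique app-var-headNormal app-var-headNormal r r' = refl

church-zero-unfold : ∀ a b c → apps (church 0) (a ∷ b ∷ c ∷ []) ≻ app b c
church-zero-unfold a b c = ≻-step (wapp (wapp wβ)) ◅◅ ≻-step (wapp wβ)

S₂-Xc-unfold : ∀ {l a b cs} u v w →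
  apps (app S₂ (Xc l a b cs)) (u ∷ v ∷ w ∷ []) ≻ apps (Xc l a b cs) (u ∷ app u v ∷ w ∷ [])
S₂-Xc-unfold {l} {a} {b} {cs} u v w =
  subst (λ u' → apps (app S₂ ν) (u ∷ v ∷ w ∷ []) ≻ apps ν (u' ∷ app u' v ∷ w ∷ []))
        (sub-shift 0 v u)
        (≻-step (wapp (wapp (wapp wβ))) ◅◅ ≻-step (wapp (wapp wβ)) ◅◅ ≻-step (wapp wβ))
  where ν = Xc l a b cs

A B T : Tm
A = lam (lam (app (var 0) (app (var 1) S₂)))
B = lam (app (var 0) (church 0))
T = lam (lam (apps (var 1) (A ∷ B ∷ var 0 ∷ [])))

Y : ℕ → Tm
Y n = iterApp n A B

τ : ℕ → Tm
τ zero    = church 0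
τ (suc m) = app (Y m) S₂

A-closed : ClosedλTerm A
A-closed = plam (plam (papp (pvar z<s) (papp (pvar (s<s z<s)) (closed-weaken S₂-closed))))

B-closed : ClosedλTerm B
B-closed = plam (papp (pvar z<s) (closed-weaken (church-closed 0)))

T-closed : ClosedλTerm T
T-closed = plam (plam (papp (papp (papp (pvar (s<s z<s)) (closed-weaken A-closed))
                                   (closed-weaken B-closed))
                             (pvar z<s)))

Y-closed : ∀ n → ClosedλTerm (Y n)
Y-closed zero    = B-closed
Y-closed (suc n) = papp A-closed (Y-closed n)

τ-closed : ∀ n → ClosedλTerm (τ n)
τ-closed zero    = church-closed 0
τ-closed (suc m) = papp (Y-closed m) S₂-closed

T-unfold : ∀ θ c → app (app T θ) c ≻ apps θ (A ∷ B ∷ c ∷ [])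
T-unfold θ c = subst (λ ν → app (app T θ) c ≻ apps ν (A ∷ B ∷ c ∷ []))
                     (sub-shift 0 c θ)
                     (≻-step (wapp wβ) ◅◅ ≻-step wβ)

A-unfold : ∀ b c → app (app A b) c ≻ app c (app b S₂)
A-unfold b c = subst (λ b' → app (app A b) c ≻ app c (app b' S₂))
                     (sub-shift 0 c b)
                     (≻-step (wapp wβ) ◅◅ ≻-step wβ)

Y-unfold : ∀ n c → app (Y n) c ≻ app c (τ n)
Y-unfold zero    c = ≻-step wβ
Y-unfold (suc m) c = A-unfold (Y m) c

τ-church : ∀ n → τ n ≃β church n
τ-church zero    = ε
τ-church (suc m) = ≻⇒≃β (Y-unfold m S₂) ◅◅ app-congʳ (τ-church m) ◅◅ S₂-church m

-- Each unfolding of S₂ moves one A into the second argument: (A)ᵏB after n − l steps.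
chain-from : ∀ {n} l k → l + k ≡ n → Chain S₂ n (τ n) (next S₂ l A (Y k) (f ∷ []))
chain-from zero    k refl = done (church-zero-unfold A (Y k) f ◅◅ Y-unfold k f)
chain-from (suc l) k refl =
  stepXc (s≤s (m≤m+n l k)) (S₂-Xc-unfold A (Y k) f) (chain-from l (suc k) (+-suc l k))

T-S₂-storage : S-StorageOperator S₂ T
T-S₂-storage = T-closed , λ n →
  τ n , τ-closed n , τ-church n , stepX (T-unfold (X n) f) (chain-from n 0 (+-identityʳ n))

one-with-redex : Tm
one-with-redex = lam (lam (app (var 1) (app (lam (var 0)) (var 0))))

one-with-redex-closed : ClosedλTerm one-with-redex
one-with-redex-closed = plam (plam (papp (pvar (s<s z<s)) (papp (plam (pvar z<s)) (pvar z<s))))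

one-with-redex-≃β : one-with-redex ≃β church 1
one-with-redex-≃β = β-step (ξlam (ξlam (ξr β)))

T-one : app (app T (church 1)) f ≻ app f (app B S₂)
T-one = T-unfold (church 1) f ◅◅ ≻-step (wapp (wapp wβ)) ◅◅ ≻-step (wapp wβ) ◅◅ A-unfold B f

T-one-with-redex : app (app T one-with-redex) f ≻ app f (app (app (lam (var 0)) B) S₂)
T-one-with-redex =
  T-unfold one-with-redex f ◅◅ ≻-step (wapp (wapp wβ)) ◅◅ ≻-step (wapp wβ) ◅◅ A-unfold _ f

T-not-storage : ¬ StorageOperator T
T-not-storage (_ , stores) with stores 1
... | _ , _ , _ , reduces
  with ≻-app-var-functional (reduces (church 1) (church-closed 1) ε) T-one
     | ≻-app-var-functional (reduces one-with-redex one-with-redex-closed one-with-redex-≃β)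
                            T-one-with-redex
... | refl | ()

theorem3 : Σ Tm λ T → S-StorageOperator S₂ T × ¬ StorageOperator T
theorem3 = T , T-S₂-storage , T-not-storage
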